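{- Let $G=(V,E)$ be a finite connected undirected graph, $q\in V$, $\sigma$ a total ordering of $E$, and $T$ a spanning tree of $G$. Then $f:=\mu(T)$ is a maximum $G$-parking function with respect to $q$ if and only if $T$ is safe with respect to $\sigma$.
   Context: An edge $e$ is larger than $f$ if $\sigma(e)>\sigma(f)$. An edge $e\notin T$ forms a broken circuit with $T$ if $e$ is the largest edge of the unique cycle in $T+e$; $T$ is safe if no edge $e\notin T$ forms a broken circuit with $T$. For a vertex $i$ let $P_i$ be the path in $T$ from $i$ to $q$; $meet(i,j)$ is the first vertex of $P_i$ lying on $P_j$; $e_{ij}$ is the largest edge on the subpath of $P_i$ from $i$ to $meet(i,j)$ (the null edge, smaller than all edges, if $i=meet(i,j)$); $i\succ j$ if $e_{ij}$ is larger than $e_{ji}$. Construction of $\mu(T)$: let $E'$ be the set of edges not in $T$ that form a broken circuit with $T$. Orient the edges of $T$ towards $q$ (every vertex other than $q$ has out-degree $1$ in $T$, $q$ has out-degree $0$), and orient every other edge $\{i,j\}\in E\setminus E'$ from $i$ to $j$ if $i\succ j$ and from $j$ to $i$ if $j\succ i$; call the resulting digraph on edge set $E\setminus E'$ $D$. Set $\mu(T)(v)=\mathrm{outdeg}_D(v)-1$. For $A\subseteq V$, $v\in A$, $d_{\overline{A}}(v)$ is the number of edges $vw$ with $w\notin A$; a $G$-parking function with respect to $q$ is $f:V\to\mathbb{Z}_{\ge -1}$ with $f(q)=-1$ such that every non-empty $A\subseteq V\setminus\{q\}$ has $v\in A$ with $0\le f(v)<d_{\overline{A}}(v)$; a maximum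 one maximizes $\sum_v f(v)$. -}

module Defs where

open import Data.Bool using (Bool; true; false; not; _∧_; _∨_; if_then_else_)
open import Data.Nat as ℕ using (ℕ; zero; suc; _⊔_; _<_; _<?_)
open import Data.Integer as ℤ using (ℤ; +_; -[1+_])
open import Data.Fin using (Fin; _≟_)
open import Data.Vec using (lookup)
open import Data.Fin.Subset using (Subset; _∈_; _∉_; Nonempty)
open import Data.List using (List; []; _∷_; length; filterᵇ; foldr; map)
open import Data.List.Relation.Unary.Any using (any?)
open import Data.List.Relation.Unary.All using (All; all?)
open import Data.List.Relation.Unary.Unique.Propositional using (Unique)
open import Data.List.Membership.Propositional using () renaming (_∉_ to _∉ₗ_)
open import Data.Product using (Σ; _×_; _,_; proj₁; proj₂; ∃)
open import Data.Sum using (_⊎_)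
open import Data.Empty using (⊥)
open import Data.Fin.Base using () renaming (Fin to F)
open import Data.List.Base using (allFin)
open import Relation.Nullary using (¬_)
open import Relation.Nullary.Decidable using (isYes)
open import Relation.Binary.PropositionalEquality using (_≡_; _≢_)

-- Vertices are Fin n, edges are Fin m, each edge e has endpoints src e, tgt e.
-- Edge e joins u and w (as an undirected edge {u,w}).
Joins : ∀ {n m} → (Fin m → Fin n) → (Fin m → Fin n) → Fin m → Fin n → Fin n → Set
Joins src tgt e u w = (src e ≡ u × tgt e ≡ w) ⊎ (src e ≡ w × tgt e ≡ u)

record Graph (n m : ℕ) : Set where
  field
    src tgt : Fin m → Fin n
    noLoop  : ∀ e → src e ≢ tgt e
    noMulti : ∀ e f → Joins src tgt f (src e) (tgt e) → e ≡ f

_=ᵥ_ : ∀ {n} → Fin n → Fin n → Bool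
x =ᵥ y = isYes (x ≟ y)

sumℤ : ∀ {n} → (Fin n → ℤ) → ℤ
sumℤ {n} f = foldr ℤ._+_ (+ 0) (map f (allFin n))

module _ {n m : ℕ} (G : Graph n m) where
  open Graph G

  data Walk (S : Fin m → Bool) : Fin n → Fin n → Set where
    []    : ∀ {u} → Walk S u u
    step  : ∀ {u w v} (e : Fin m) → S e ≡ true → Joins src tgt e u w → Walk S w v → Walk S u v

  verts : ∀ {S u v} → Walk S u v → List (Fin n)
  verts ([] {u}) = u ∷ []
  verts (step {u} e _ _ p) = u ∷ verts p

  edges : ∀ {S u v} → Walk S u v → List (Fin m)
  edges [] = []
  edges (step e _ _ p) = e ∷ edges p

  Path : (Fin m → Bool) → Fin n → Fin n → Set
  Path S u v = Σ (Walk S u v) (λ p → Unique (verts p))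

  Connected : Set
  Connected = ∀ u v → Path (λ _ → true) u v

  record SpanningTree (T : Fin m → Bool) : Set where
    field
      connected : ∀ u v → Path T u v
      acyclic   : ∀ e → T e ≡ true → (p : Path T (src e) (tgt e)) → e ∉ₗ edges (proj₁ p) → ⊥

  module _ (q : Fin n) (σ : Fin m → ℕ) (T : Fin m → Bool) (t : SpanningTree T) where
    open SpanningTree t

    treePath : ∀ u v → Walk T u v
    treePath u v = proj₁ (connected u v)

    -- e (not in T) forms a broken circuit with T: e is the largest edge of
    -- the unique cycle of T + e, i.e. larger than every edge of the T-path
    -- between its endpoints.
    BrokenCircuit : Fin m → Set
    BrokenCircuit e = T e ≡ false × All (λ f → σ f < σ e) (edges (treePath (src e) (tgt e)))

    brokenᵇ : Fin m → Bool
    brokenᵇ e = not (T e) ∧ isYes (all? (λ f → σ f <? σ e) (edges (treePath (src e) (tgt e))))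

    Safe : Set
    Safe = ∀ e → ¬ BrokenCircuit e

    P : (i : Fin n) → Walk T i q
    P i = treePath i q

    onPath : ∀ {u v} → Walk T u v → Fin n → Bool
    onPath p x = isYes (any? (x ≟_) (verts p))

    -- value of the largest edge on the initial segment of a walk before the
    -- first vertex satisfying `stop`; edge f has value suc (σ f), the null
    -- edge has value 0 (smaller than all edges).
    prefMax : ∀ {u v} → (Fin n → Bool) → Walk T u v → ℕ
    prefMax stop [] = 0
    prefMax stop (step {u} e _ _ p) = if stop u then 0 else (suc (σ e) ⊔ prefMax stop p)

    -- value of e_{ij}: largest edge on P_i from i to meet(i,j)
    eVal : Fin n → Fin n → ℕ
    eVal i j = prefMax (onPath (P j)) (P i)

    _≻ᵇ_ : Fin n → Fin n → Bool
    i ≻ᵇ j = eVal j i ℕ.<ᵇ eVal i j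

    firstEdgeIs : ∀ {u v} → Fin m → Walk T u v → Bool
    firstEdgeIs e [] = false
    firstEdgeIs e (step f _ _ _) = isYes (e ≟ f)

    outFrom : Fin n → Fin m → Bool
    outFrom v e =
      if T e then firstEdgeIs e (P v)
      else (not (brokenᵇ e) ∧
             ((src e =ᵥ v ∧ (src e ≻ᵇ tgt e)) ∨ (tgt e =ᵥ v ∧ (tgt e ≻ᵇ src e))))

    outdeg : Fin n → ℕ
    outdeg v = length (filterᵇ (outFrom v) (allFin m))

    μ : Fin n → ℤ
    μ v = + outdeg v ℤ.- + 1

  dOut : Subset n → Fin n → ℕ
  dOut A v = length (filterᵇ
    (λ e → (src e =ᵥ v ∧ not (lookup A (tgt e)))
         ∨ (tgt e =ᵥ v ∧ not (lookup A (src e))))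
    (allFin m))

  IsParking : Fin n → (Fin n → ℤ) → Set
  IsParking q f =
    f q ≡ -[1+ 0 ] ×
    (∀ v → -[1+ 0 ] ℤ.≤ f v) ×
    (∀ (A : Subset n) → Nonempty A → q ∉ A →
       ∃ λ v → v ∈ A × (+ 0 ℤ.≤ f v) × (f v ℤ.< + dOut A v))

  IsMaxParking : Fin n → (Fin n → ℤ) → Set
  IsMaxParking q f = IsParking q f × (∀ g → IsParking q g → sumℤ g ℤ.≤ sumℤ f)

-- The potential π(v) = Σ_{e ∈ P_v} 2^σ(e) strictly decreases along every edge of D: along tree edges because
-- P_v starts with the tree edge out of v, along non-tree edges because i ≻ j means that the largest edge where
-- P_i and P_j differ lies on P_i. Hence D is acyclic with sink q, and for such an orientation outdeg − 1 is a
-- parking function (a vertex of minimal potential in A sends all its out-edges out of A), of degree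
-- (#oriented edges) − n. Every parking function has degree at most m − n (peel off the vertices supplied by the
-- parking condition), and m − n is attained by orienting all edges along a tie-broken potential. Since σ is
-- injective, e_{ij} ≠ e_{ji} for i ≠ j, so the unoriented edges of D are exactly the broken circuits; thus μ(T)
-- is maximum iff there are none.

module Submission where

open import Defs
open import Data.Bool using (Bool; true; false; not; _∧_; _∨_; T)
open import Data.Empty using (⊥; ⊥-elim)
open import Data.Fin using (Fin; _≟_; toℕ)
open import Data.Fin.Properties using (toℕ<n; toℕ-injective)
open import Data.Fin.Subset using (Subset; Nonempty) renaming (_∈_ to _∈ₛ_; _∉_ to _∉ₛ_)
open import Data.Fin.Subset.Properties using (_∈?_; nonempty?)
open import Data.Integer as ℤ using (ℤ; -[1+_]; ∣_∣; +≤+; +<+; -≤-; -≤+) renaming (+_ to ⁺_)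
import Data.Integer.Properties as ℤP
open import Data.Integer.Tactic.RingSolver using (solve-∀)
open import Data.List using (List; []; _∷_; _++_; length; map; foldr; filter; filterᵇ; allFin)
open import Data.List.Properties using (length-tabulate; length-filter; map-++; map-cong; filter-all; filter-accept; filter-reject; ++-assoc; ++-identityˡ-unique; ++-conicalˡ; ++-conicalʳ)
open import Data.List.Membership.Propositional using (_∈_; _∉_)
open import Data.List.Membership.Propositional.Properties using (∈-++⁻; ∈-++⁺ˡ; ∈-++⁺ʳ; ∈-map⁺; ∈-map⁻; ∈-allFin; ∈-filter⁺; ∈-filter⁻)
open import Data.List.Relation.Binary.Subset.Propositional using (_⊆_)
open import Data.List.Relation.Unary.All using (All; all?)
import Data.List.Relation.Unary.All as All
open import Data.List.Relation.Unary.All.Properties using (¬Any⇒All¬; all-filter)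
open import Data.List.Relation.Unary.AllPairs using ([]; _∷_; tail)
open import Data.List.Relation.Unary.Any using (here; there; any?)
open import Data.List.Relation.Unary.Unique.Propositional using (Unique)
open import Data.List.Relation.Unary.Unique.Propositional.Properties using (Unique[x∷xs]⇒x∉xs; map⁺; allFin⁺; filter⁺)
open import Data.Nat as ℕ using (ℕ; zero; suc; _+_; _*_; _^_; _≤_; _<_; _⊔_; z≤n; s≤s)
open import Data.Nat.Properties hiding (_≟_)
open import Algebra.Properties.CommutativeSemigroup +-commutativeSemigroup using (interchange; x∙yz≈y∙xz)
open import Data.Product using (Σ; _×_; _,_; proj₁; proj₂; ∃)
open import Data.Sum using (_⊎_; inj₁; inj₂)
open import Data.Unit using (tt)
open import Data.Vec using (lookup; tabulate)
open import Data.Vec.Properties using (lookup∘tabulate; lookup⇒[]=; []=⇒lookup)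
open import Function.Definitions using (Injective)
open import Function.Bundles using (_⇔_; mk⇔)
open import Relation.Binary.Definitions using (tri<; tri≈; tri>)
open import Relation.Binary.PropositionalEquality
  using (_≡_; _≢_; refl; sym; trans; cong; cong₂; subst; subst₂; module ≡-Reasoning)
open import Relation.Nullary using (¬?; yes; no)
open import Relation.Nullary.Decidable using (toWitness)

open import Data.List.Extrema ≤-totalOrder using (argmin; argmin-all; f[argmin]≤f[xs])

bool-cases : ∀ (b : Bool) → (b ≡ true) ⊎ (b ≡ false)
bool-cases true  = inj₁ refl
bool-cases false = inj₂ refl

∧-true : ∀ {a b : Bool} → a ∧ b ≡ true → (a ≡ true) × (b ≡ true)
∧-true {true} {true} _ = refl , refl

∨-true : ∀ {a b : Bool} → a ∨ b ≡ true → (a ≡ true) ⊎ (b ≡ true)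
∨-true {true}  _ = inj₁ refl
∨-true {false} h = inj₂ h

<ᵇ⇒<′ : ∀ {a b} → (a ℕ.<ᵇ b) ≡ true → a < b
<ᵇ⇒<′ {a} {b} h = <ᵇ⇒< a b (subst T (sym h) tt)

<⇒<ᵇ′ : ∀ {a b} → a < b → (a ℕ.<ᵇ b) ≡ true
<⇒<ᵇ′ {a} {b} a<b with a ℕ.<ᵇ b | <⇒<ᵇ a<b
... | true | _ = refl

=ᵥ⇒≡ : ∀ {n} {x y : Fin n} → (x =ᵥ y) ≡ true → x ≡ y
=ᵥ⇒≡ {x = x} {y} h = toWitness {a? = x ≟ y} (subst T (sym h) tt)

=ᵥ-refl : ∀ {n} (x : Fin n) → (x =ᵥ x) ≡ true
=ᵥ-refl x with x ≟ x
... | yes _   = refl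
... | no x≢x  = ⊥-elim (x≢x refl)

=ᵥ-≢ : ∀ {n} {x y : Fin n} → x ≢ y → (x =ᵥ y) ≡ false
=ᵥ-≢ {x = x} {y} x≢y with x ≟ y
... | yes x≡y = ⊥-elim (x≢y x≡y)
... | no _    = refl

ind : Bool → ℕ
ind true  = 1
ind false = 0

module _ {A : Set} where

  Unique-∷ : ∀ {x : A} {xs} → x ∉ xs → Unique xs → Unique (x ∷ xs)
  Unique-∷ {xs = xs} x∉ u = ¬Any⇒All¬ xs x∉ ∷ u

  ∑ : (A → ℕ) → List A → ℕ
  ∑ f = foldr (λ x r → f x + r) 0

  count : (A → Bool) → List A → ℕ
  count p xs = length (filterᵇ p xs)

  count-∷ : ∀ (p : A → Bool) x xs → count p (x ∷ xs) ≡ ind (p x) + count p xs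
  count-∷ p x xs with p x
  ... | true  = refl
  ... | false = refl

  count≡∑ind : ∀ (p : A → Bool) xs → count p xs ≡ ∑ (λ x → ind (p x)) xs
  count≡∑ind p []       = refl
  count≡∑ind p (x ∷ xs) = trans (count-∷ p x xs) (cong (ind (p x) +_) (count≡∑ind p xs))

  ∑-cong : ∀ {f g : A → ℕ} xs → (∀ x → f x ≡ g x) → ∑ f xs ≡ ∑ g xs
  ∑-cong []       _   = refl
  ∑-cong (x ∷ xs) f≗g = cong₂ _+_ (f≗g x) (∑-cong xs f≗g)

  ∑-+ : ∀ (f g : A → ℕ) xs → ∑ (λ x → f x + g x) xs ≡ ∑ f xs + ∑ g xs
  ∑-+ f g []       = refl
  ∑-+ f g (x ∷ xs) = trans (cong (f x + g x +_) (∑-+ f g xs)) (interchange (f x) (g x) (∑ f xs) (∑ g xs))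

  ∑-zero : ∀ (f : A → ℕ) xs → (∀ x → x ∈ xs → f x ≡ 0) → ∑ f xs ≡ 0
  ∑-zero f []       _  = refl
  ∑-zero f (x ∷ xs) f0 rewrite f0 x (here refl) = ∑-zero f xs (λ y y∈ → f0 y (there y∈))

  length≤∑ : ∀ (f : A → ℕ) xs → (∀ x → x ∈ xs → 1 ≤ f x) → length xs ≤ ∑ f xs
  length≤∑ f []       _  = z≤n
  length≤∑ f (x ∷ xs) f1 = +-mono-≤ (f1 x (here refl)) (length≤∑ f xs (λ y y∈ → f1 y (there y∈)))

  ∑≤length : ∀ (f : A → ℕ) xs → (∀ x → f x ≤ 1) → ∑ f xs ≤ length xs
  ∑≤length f []       _  = z≤n
  ∑≤length f (x ∷ xs) f1 = +-mono-≤ (f1 x) (∑≤length f xs f1)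

  ∑<length : ∀ (f : A → ℕ) xs {y} → (∀ x → f x ≤ 1) → y ∈ xs → f y ≡ 0 → ∑ f xs < length xs
  ∑<length f (x ∷ xs) f1 (here refl) fy≡0 rewrite fy≡0 = s≤s (∑≤length f xs f1)
  ∑<length f (x ∷ xs) f1 (there y∈) fy≡0 =
    s≤s (≤-trans (+-monoˡ-≤ (∑ f xs) (f1 x)) (∑<length f xs f1 y∈ fy≡0))

  count≤length : ∀ (p : A → Bool) xs → count p xs ≤ length xs
  count≤length p = length-filter _

  count-none : ∀ (p : A → Bool) xs → (∀ x → x ∈ xs → p x ≡ false) → count p xs ≡ 0
  count-none p xs none = trans (count≡∑ind p xs) (∑-zero _ xs (λ x x∈ → cong ind (none x x∈)))

  count-pos : ∀ (p : A → Bool) {x} xs → x ∈ xs → p x ≡ true → 1 ≤ count p xs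
  count-pos p (y ∷ xs) (here refl) px rewrite count-∷ p y xs | px = s≤s z≤n
  count-pos p (y ∷ xs) (there x∈) px rewrite count-∷ p y xs = ≤-trans (count-pos p xs x∈ px) (m≤n+m _ _)

  count-mono : ∀ (p r : A → Bool) xs → (∀ x → p x ≡ true → r x ≡ true) → count p xs ≤ count r xs
  count-mono p r []       p⇒r = z≤n
  count-mono p r (x ∷ xs) p⇒r rewrite count-∷ p x xs | count-∷ r x xs with bool-cases (p x)
  ... | inj₁ px rewrite px | p⇒r x px = s≤s (count-mono p r xs p⇒r)
  ... | inj₂ px rewrite px = ≤-trans (count-mono p r xs p⇒r) (m≤n+m _ _)

  count≤1 : ∀ (p : A → Bool) xs → Unique xs → (∀ x y → p x ≡ true → p y ≡ true → x ≡ y) → count p xs ≤ 1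
  count≤1 p []       _ _      = z≤n
  count≤1 p (x ∷ xs) u p-prop rewrite count-∷ p x xs with bool-cases (p x)
  ... | inj₁ px rewrite px = ≤-reflexive (cong suc (count-none p xs none))
    where
      none : ∀ y → y ∈ xs → p y ≡ false
      none y y∈ with bool-cases (p y)
      ... | inj₁ py = ⊥-elim (Unique[x∷xs]⇒x∉xs u (subst (_∈ xs) (p-prop y x py px) y∈))
      ... | inj₂ py = py
  ... | inj₂ px rewrite px = count≤1 p xs (tail u) p-prop

∑-swap-count : ∀ {A B : Set} (r : A → B → Bool) (xs : List A) (ys : List B) →
               ∑ (λ x → count (r x) ys) xs ≡ ∑ (λ y → count (λ x → r x y) xs) ys
∑-swap-count r xs []       = ∑-zero _ xs (λ _ _ → refl)
∑-swap-count r xs (y ∷ ys) = begin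
    ∑ (λ x → count (r x) (y ∷ ys)) xs             ≡⟨ ∑-cong xs (λ x → count-∷ (r x) y ys) ⟩
    ∑ (λ x → ind (r x y) + count (r x) ys) xs     ≡⟨ ∑-+ (λ x → ind (r x y)) (λ x → count (r x) ys) xs ⟩
    ∑ (λ x → ind (r x y)) xs + ∑ (λ x → count (r x) ys) xs
      ≡⟨ cong₂ _+_ (sym (count≡∑ind (λ x → r x y) xs)) (∑-swap-count r xs ys) ⟩
    count (λ x → r x y) xs + ∑ (λ y → count (λ x → r x y) xs) ys ∎
  where open ≡-Reasoning

∑ℤ-pred : ∀ {A : Set} (h : A → ℕ) xs →
          foldr ℤ._+_ (⁺ 0) (map (λ x → ⁺ h x ℤ.- ⁺ 1) xs) ≡ ⁺ ∑ h xs ℤ.- ⁺ length xs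
∑ℤ-pred h []       = refl
∑ℤ-pred h (x ∷ xs) rewrite ∑ℤ-pred h xs =
  trans (regroup (⁺ h x) (⁺ ∑ h xs) (⁺ length xs))
        (cong₂ ℤ._-_ (sym (ℤP.pos-+ (h x) (∑ h xs))) (sym (ℤP.pos-+ 1 (length xs))))
  where
    regroup : ∀ (a b c : ℤ) → (a ℤ.- ⁺ 1) ℤ.+ (b ℤ.- c) ≡ (a ℤ.+ b) ℤ.- (⁺ 1 ℤ.+ c)
    regroup = solve-∀

length-allFin : ∀ n → length (allFin n) ≡ n
length-allFin n = length-tabulate (λ x → x)

weight : List ℕ → ℕ
weight = foldr (λ a r → 2 ^ a + r) 0

weight-++ : ∀ xs ys → weight (xs ++ ys) ≡ weight xs + weight ys
weight-++ []       ys = refl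
weight-++ (a ∷ xs) ys = trans (cong (2 ^ a +_) (weight-++ xs ys)) (sym (+-assoc (2 ^ a) _ _))

weight-∈ : ∀ {a} ks → a ∈ ks → 2 ^ a ≤ weight ks
weight-∈ (a ∷ ks) (here refl) = m≤m+n _ _
weight-∈ (b ∷ ks) (there a∈)  = ≤-trans (weight-∈ ks a∈) (m≤n+m _ _)

without : ℕ → List ℕ → List ℕ
without k = filter (λ a → ¬? (k ℕ.≟ a))

weight-without : ∀ k ks → Unique ks → weight ks ≤ 2 ^ k + weight (without k ks)
weight-without k []       _ = z≤n
weight-without k (a ∷ ks) u with k ℕ.≟ a
... | yes refl = ≤-reflexive (cong (λ xs → 2 ^ a + weight xs) (sym (begin
    without a (a ∷ ks) ≡⟨ filter-reject (λ b → ¬? (a ℕ.≟ b)) (λ a≢a → a≢a refl) ⟩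
    without a ks       ≡⟨ filter-all (λ b → ¬? (a ℕ.≟ b)) (¬Any⇒All¬ ks (Unique[x∷xs]⇒x∉xs u)) ⟩
    ks                 ∎)))
  where open ≡-Reasoning
... | no k≢a   = begin
    2 ^ a + weight ks                         ≤⟨ +-monoʳ-≤ (2 ^ a) (weight-without k ks (tail u)) ⟩
    2 ^ a + (2 ^ k + weight (without k ks))   ≡⟨ x∙yz≈y∙xz (2 ^ a) (2 ^ k) _ ⟩
    2 ^ k + (2 ^ a + weight (without k ks))   ≡⟨ cong (λ xs → 2 ^ k + weight xs) (filter-accept (λ b → ¬? (k ℕ.≟ b)) k≢a) ⟨
    2 ^ k + weight (without k (a ∷ ks))       ∎
  where open ≤-Reasoning

weight-< : ∀ k ks → Unique ks → (∀ {a} → a ∈ ks → a < k) → weight ks < 2 ^ k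
weight-< zero    []       _ _  = s≤s z≤n
weight-< zero    (a ∷ ks) _ <0 with () ← <0 (here refl)
weight-< (suc k) ks       u <k = begin-strict
    weight ks                          ≤⟨ weight-without k ks u ⟩
    2 ^ k + weight (without k ks)      <⟨ +-monoʳ-< (2 ^ k) (weight-< k (without k ks) (filter⁺ _ u) <k′) ⟩
    2 ^ k + 2 ^ k                      ≡⟨ cong (2 ^ k +_) (sym (+-identityʳ (2 ^ k))) ⟩
    2 ^ suc k                          ∎
  where
    open ≤-Reasoning
    <k′ : ∀ {a} → a ∈ without k ks → a < k
    <k′ a∈ with a∈ks , k≢a ← ∈-filter⁻ (λ a → ¬? (k ℕ.≟ a)) a∈ = ≤∧≢⇒< (≤-pred (<k a∈ks)) (λ a≡k → k≢a (sym a≡k))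

-- Walks and paths

module _ {n m : ℕ} (G : Graph n m) where
  open Graph G

  Joins-sym : ∀ {e u w} → Joins src tgt e u w → Joins src tgt e w u
  Joins-sym (inj₁ ends) = inj₂ ends
  Joins-sym (inj₂ ends) = inj₁ ends

  Joins-functional : ∀ {e u w w′} → Joins src tgt e u w → Joins src tgt e u w′ → w ≡ w′
  Joins-functional     (inj₁ (refl , refl)) (inj₁ (refl , refl)) = refl
  Joins-functional {e} (inj₁ (refl , refl)) (inj₂ (_ , t≡s))     = ⊥-elim (noLoop e (sym t≡s))
  Joins-functional {e} (inj₂ (s≡w , t≡u))   (inj₁ (s≡u , _))     = ⊥-elim (noLoop e (trans s≡u (sym t≡u)))
  Joins-functional     (inj₂ (s≡w , refl))  (inj₂ (s≡w′ , refl)) = trans (sym s≡w) s≡w′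

  Joins-endpoint : ∀ {e u w} → Joins src tgt e u w → (u ≡ src e) ⊎ (u ≡ tgt e)
  Joins-endpoint (inj₁ (s≡u , _)) = inj₁ (sym s≡u)
  Joins-endpoint (inj₂ (_ , t≡u)) = inj₂ (sym t≡u)

  module _ {S : Fin m → Bool} where

    _++ʷ_ : ∀ {a b c} → Walk G S a b → Walk G S b c → Walk G S a c
    []             ++ʷ q = q
    step e s j p   ++ʷ q = step e s j (p ++ʷ q)

    edges-++ʷ : ∀ {a b c} (p : Walk G S a b) (q : Walk G S b c) → edges G (p ++ʷ q) ≡ edges G p ++ edges G q
    edges-++ʷ []             q = refl
    edges-++ʷ (step e s j p) q = cong (e ∷_) (edges-++ʷ p q)

    reverseʷ : ∀ {a b} → Walk G S a b → Walk G S b a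
    reverseʷ []             = []
    reverseʷ (step e s j p) = reverseʷ p ++ʷ step e s (Joins-sym j) []

    edges-reverseʷ : ∀ {a b} (p : Walk G S a b) → edges G (reverseʷ p) ⊆ edges G p
    edges-reverseʷ (step e s j p) x∈ rewrite edges-++ʷ (reverseʷ p) (step e s (Joins-sym j) []) with ∈-++⁻ (edges G (reverseʷ p)) x∈
    ... | inj₁ x∈p         = there (edges-reverseʷ p x∈p)
    ... | inj₂ (here refl) = here refl

    head∈verts : ∀ {a b} (p : Walk G S a b) → a ∈ verts G p
    head∈verts []             = here refl
    head∈verts (step e s j p) = here refl

    last∈verts : ∀ {a b} (p : Walk G S a b) → b ∈ verts G p
    last∈verts []             = here refl
    last∈verts (step e s j p) = there (last∈verts p)

    endpoints∈verts : ∀ {a b e} (p : Walk G S a b) → e ∈ edges G p → (src e ∈ verts G p) × (tgt e ∈ verts G p)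
    endpoints∈verts (step e s (inj₁ (refl , t≡w)) p) (here refl) = here refl , there (subst (_∈ verts G p) (sym t≡w) (head∈verts p))
    endpoints∈verts (step e s (inj₂ (s≡w , refl)) p) (here refl) = there (subst (_∈ verts G p) (sym s≡w) (head∈verts p)) , here refl
    endpoints∈verts (step e s j p) (there e∈) with s∈ , t∈ ← endpoints∈verts p e∈ = there s∈ , there t∈

    joined∈verts : ∀ {a b e u w} (p : Walk G S a b) → e ∈ edges G p → Joins src tgt e u w → u ∈ verts G p
    joined∈verts p e∈ j with Joins-endpoint j
    ... | inj₁ refl = proj₁ (endpoints∈verts p e∈)
    ... | inj₂ refl = proj₂ (endpoints∈verts p e∈)

    edges≡[]⇒≡ : ∀ {a b} (p : Walk G S a b) → edges G p ≡ [] → a ≡ b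
    edges≡[]⇒≡ [] _ = refl

    path⇒Unique-edges : ∀ {a b} (p : Walk G S a b) → Unique (verts G p) → Unique (edges G p)
    path⇒Unique-edges []             _ = []
    path⇒Unique-edges (step e s j p) u =
      Unique-∷ (λ e∈ → Unique[x∷xs]⇒x∉xs u (joined∈verts p e∈ j)) (path⇒Unique-edges p (tail u))

    record SplitAt {a b} (c : Fin n) (p : Walk G S a b) : Set where
      field
        pre         : Walk G S a c
        suf         : Walk G S c b
        edges-split : edges G p ≡ edges G pre ++ edges G suf
        suf-unique  : Unique (verts G suf)

    splitAt : ∀ {a b c} (p : Walk G S a b) → Unique (verts G p) → c ∈ verts G p → SplitAt c p
    splitAt []             u (here refl) = record { pre = [] ; suf = [] ; edges-split = refl ; suf-unique = u }
    splitAt (step e s j p) u (here refl) = record { pre = [] ; suf = step e s j p ; edges-split = refl ; suf-unique = u }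
    splitAt (step e s j p) u (there c∈)  = record
      { pre = step e s j pre ; suf = suf ; edges-split = cong (e ∷_) edges-split ; suf-unique = suf-unique }
      where open SplitAt (splitAt p (tail u) c∈)

    walk⇒path : ∀ {a b} (W : Walk G S a b) → Σ (Walk G S a b) λ p → Unique (verts G p) × (edges G p ⊆ edges G W)
    walk⇒path [] = [] , Unique-∷ (λ ()) [] , (λ x∈ → x∈)
    walk⇒path {a} (step e s j W) with p , u , p⊆W ← walk⇒path W | any? (a ≟_) (verts G p)
    ... | yes a∈ = suf , suf-unique , λ x∈ → there (p⊆W (subst (_ ∈_) (sym edges-split) (∈-++⁺ʳ (edges G pre) x∈)))
      where open SplitAt (splitAt p u a∈)
    ... | no a∉  = step e s j p , Unique-∷ a∉ u , λ { (here refl) → here refl ; (there x∈) → there (p⊆W x∈) }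

  module _ {T : Fin m → Bool} (t : SpanningTree G T) where
    open SpanningTree t

    no-cycle : ∀ {e u w} → T e ≡ true → Joins src tgt e u w → (W : Walk G T u w) → e ∉ edges G W → ⊥
    no-cycle {e} Te (inj₁ (refl , refl)) W e∉W with p , u , p⊆W ← walk⇒path W =
      acyclic e Te (p , u) (λ e∈p → e∉W (p⊆W e∈p))
    no-cycle {e} Te (inj₂ (refl , refl)) W e∉W with p , u , p⊆W ← walk⇒path (reverseʷ W) =
      acyclic e Te (p , u) (λ e∈p → e∉W (edges-reverseʷ W (p⊆W e∈p)))

    tree-path-unique : ∀ {a b} (p q : Walk G T a b) → Unique (verts G p) → Unique (verts G q) → edges G p ≡ edges G q
    tree-path-unique []               []               _  _  = refl
    tree-path-unique []               (step e s j q)   _  uq = ⊥-elim (Unique[x∷xs]⇒x∉xs uq (last∈verts q))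
    tree-path-unique (step e s j p)   []               up _  = ⊥-elim (Unique[x∷xs]⇒x∉xs up (last∈verts p))
    tree-path-unique (step e₁ s₁ j₁ p) (step e₂ s₂ j₂ q) up uq with e₁ ≟ e₂
    ... | yes refl with refl ← Joins-functional j₁ j₂ = cong (e₁ ∷_) (tree-path-unique p q (tail up) (tail uq))
    ... | no e₁≢e₂ = ⊥-elim (no-cycle s₁ (Joins-sym j₁) W e₁∉W)
      where
        back = step e₂ s₂ (Joins-sym j₂) []
        W = p ++ʷ (reverseʷ q ++ʷ back)
        e₁∉W : e₁ ∉ edges G W
        e₁∉W e₁∈ rewrite edges-++ʷ p (reverseʷ q ++ʷ back) with ∈-++⁻ (edges G p) e₁∈
        ... | inj₁ e₁∈p = Unique[x∷xs]⇒x∉xs up (joined∈verts p e₁∈p j₁)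
        ... | inj₂ e₁∈qb rewrite edges-++ʷ (reverseʷ q) back with ∈-++⁻ (edges G (reverseʷ q)) e₁∈qb
        ...   | inj₁ e₁∈q       = Unique[x∷xs]⇒x∉xs uq (joined∈verts q (edges-reverseʷ q e₁∈q) j₁)
        ...   | inj₂ (here e₁≡e₂) = e₁≢e₂ e₁≡e₂

-- Parking functions from rooted orientations

argmin-subset : ∀ {n} (key : Fin n → ℕ) (A : Subset n) → Nonempty A →
                Σ (Fin n) λ v → v ∈ₛ A × (∀ {w} → w ∈ₛ A → key v ≤ key w)
argmin-subset {n} key A (v₀ , v₀∈A) =
  argmin key v₀ xs ,
  argmin-all key v₀∈A (all-filter (_∈? A) (allFin n)) ,
  λ w∈A → All.lookup (f[argmin]≤f[xs] {f = key} v₀ xs) (∈-filter⁺ (_∈? A) (∈-allFin _) w∈A)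
  where xs = filter (_∈? A) (allFin n)

∉ₛ⇒lookup≡false : ∀ {n} (A : Subset n) x → x ∉ₛ A → lookup A x ≡ false
∉ₛ⇒lookup≡false A x x∉A with bool-cases (lookup A x)
... | inj₁ x∈A = ⊥-elim (x∉A (lookup⇒[]= x A x∈A))
... | inj₂ x∉A = x∉A

lookup≡false⇒∉ₛ : ∀ {n} (A : Subset n) x → lookup A x ≡ false → x ∉ₛ A
lookup≡false⇒∉ₛ A x x∉A x∈A with () ← trans (sym ([]=⇒lookup x∈A)) x∉A

module _ {n m : ℕ} (G : Graph n m) where
  open Graph G

  leaves : Subset n → Fin n → Fin m → Bool
  leaves A v e = (src e =ᵥ v ∧ not (lookup A (tgt e))) ∨ (tgt e =ᵥ v ∧ not (lookup A (src e)))

  leaves-src : ∀ A e → lookup A (tgt e) ≡ false → leaves A (src e) e ≡ true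
  leaves-src A e tgt∉A rewrite =ᵥ-refl (src e) | tgt∉A = refl

  leaves-tgt : ∀ A e → lookup A (src e) ≡ false → leaves A (tgt e) e ≡ true
  leaves-tgt A e src∉A rewrite =ᵥ-≢ (noLoop e) | =ᵥ-refl (tgt e) | src∉A = refl

  record RootedOrientation (q : Fin n) : Set where
    field
      out          : Fin n → Fin m → Bool
      key          : Fin n → ℕ
      out-descends : ∀ v e → out v e ≡ true → (src e ≡ v × key (tgt e) < key v) ⊎ (tgt e ≡ v × key (src e) < key v)
      root-minimal : ∀ w → key q ≤ key w
      out-nonempty : ∀ v → v ≢ q → Σ (Fin m) λ e → out v e ≡ true

    outdegree : Fin n → ℕ
    outdegree v = count (out v) (allFin m)

    parkingFn : Fin n → ℤ
    parkingFn v = ⁺ outdegree v ℤ.- ⁺ 1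

    outdegree-root : outdegree q ≡ 0
    outdegree-root = count-none (out q) (allFin m) (λ e _ → root-out e)
      where
        root-out : ∀ e → out q e ≡ false
        root-out e with bool-cases (out q e)
        ... | inj₂ ¬out = ¬out
        ... | inj₁ out-q with out-descends q e out-q
        ...   | inj₁ (_ , lt) = ⊥-elim (<⇒≱ lt (root-minimal _))
        ...   | inj₂ (_ , lt) = ⊥-elim (<⇒≱ lt (root-minimal _))

    outdegree≤dOut : ∀ A v → v ∈ₛ A → (∀ {w} → w ∈ₛ A → key v ≤ key w) → outdegree v ≤ dOut G A v
    outdegree≤dOut A v v∈A v-min = count-mono (out v) (leaves A v) (allFin m) out⇒leaves
      where
        out⇒leaves : ∀ e → out v e ≡ true → leaves A v e ≡ true
        out⇒leaves e out-v with out-descends v e out-v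
        ... | inj₁ (refl , lt) = leaves-src A e (∉ₛ⇒lookup≡false A (tgt e) (λ t∈A → <⇒≱ lt (v-min t∈A)))
        ... | inj₂ (refl , lt) = leaves-tgt A e (∉ₛ⇒lookup≡false A (src e) (λ s∈A → <⇒≱ lt (v-min s∈A)))

    isParking : IsParking G q parkingFn
    isParking = cong (λ k → ⁺ k ℤ.- ⁺ 1) outdegree-root , (λ v → ≥-1 (outdegree v)) , condition
      where
        ≥-1 : ∀ k → -[1+ 0 ] ℤ.≤ ⁺ k ℤ.- ⁺ 1
        ≥-1 zero    = -≤- z≤n
        ≥-1 (suc k) = -≤+
        pred-in-range : ∀ k d → 1 ≤ k → k ≤ d → (⁺ 0 ℤ.≤ ⁺ k ℤ.- ⁺ 1) × (⁺ k ℤ.- ⁺ 1 ℤ.< ⁺ d)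
        pred-in-range (suc k) d (s≤s z≤n) k<d = +≤+ z≤n , +<+ k<d
        condition : ∀ A → Nonempty A → q ∉ₛ A → ∃ λ v → v ∈ₛ A × (⁺ 0 ℤ.≤ parkingFn v) × (parkingFn v ℤ.< ⁺ dOut G A v)
        condition A A≠∅ q∉A with v , v∈A , v-min ← argmin-subset key A A≠∅
                               with e , out-v ← out-nonempty v (λ { refl → q∉A v∈A }) =
          v , v∈A , pred-in-range (outdegree v) (dOut G A v)
                      (count-pos (out v) (allFin m) (∈-allFin e) out-v) (outdegree≤dOut A v v∈A v-min)

    sumℤ-parkingFn : sumℤ parkingFn ≡ ⁺ ∑ outdegree (allFin n) ℤ.- ⁺ n
    sumℤ-parkingFn = trans (∑ℤ-pred outdegree (allFin n)) (cong (λ k → ⁺ ∑ outdegree (allFin n) ℤ.- ⁺ k) (length-allFin n))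

    ∑outdegree≡∑tails : ∑ outdegree (allFin n) ≡ ∑ (λ e → count (λ v → out v e) (allFin n)) (allFin m)
    ∑outdegree≡∑tails = ∑-swap-count out (allFin n) (allFin m)

    out-unique : ∀ e v w → out v e ≡ true → out w e ≡ true → v ≡ w
    out-unique e v w out-v out-w with out-descends v e out-v | out-descends w e out-w
    ... | inj₁ (refl , _)  | inj₁ (refl , _)  = refl
    ... | inj₂ (refl , _)  | inj₂ (refl , _)  = refl
    ... | inj₁ (refl , l₁) | inj₂ (refl , l₂) = ⊥-elim (<-asym l₁ l₂)
    ... | inj₂ (refl , l₁) | inj₁ (refl , l₂) = ⊥-elim (<-asym l₁ l₂)

    all-oriented⇒m≤∑outdegree : (∀ e → Σ (Fin n) λ v → out v e ≡ true) → m ≤ ∑ outdegree (allFin n)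
    all-oriented⇒m≤∑outdegree oriented = subst₂ _≤_ (length-allFin m) (sym ∑outdegree≡∑tails)
      (length≤∑ _ (allFin m) λ e _ → count-pos (λ v → out v e) (allFin n) (∈-allFin (proj₁ (oriented e))) (proj₂ (oriented e)))

    unoriented⇒∑outdegree<m : ∀ e → (∀ v → out v e ≡ false) → ∑ outdegree (allFin n) < m
    unoriented⇒∑outdegree<m e unoriented = subst₂ _<_ (sym ∑outdegree≡∑tails) (length-allFin m)
      (∑<length _ (allFin m)
        (λ e → count≤1 (λ v → out v e) (allFin n) (allFin⁺ n) (out-unique e))
        (∈-allFin e) (count-none (λ v → out v e) (allFin n) (λ v _ → unoriented v)))

    all-oriented⇒m-n≤sum : (∀ e → Σ (Fin n) λ v → out v e ≡ true) → ⁺ m ℤ.- ⁺ n ℤ.≤ sumℤ parkingFn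
    all-oriented⇒m-n≤sum oriented =
      subst (⁺ m ℤ.- ⁺ n ℤ.≤_) (sym sumℤ-parkingFn) (ℤP.+-monoˡ-≤ (ℤ.- ⁺ n) (+≤+ (all-oriented⇒m≤∑outdegree oriented)))

    unoriented⇒sum<m-n : ∀ e → (∀ v → out v e ≡ false) → sumℤ parkingFn ℤ.< ⁺ m ℤ.- ⁺ n
    unoriented⇒sum<m-n e unoriented =
      subst (ℤ._< ⁺ m ℤ.- ⁺ n) (sym sumℤ-parkingFn) (ℤP.+-monoˡ-< (ℤ.- ⁺ n) (+<+ (unoriented⇒∑outdegree<m e unoriented)))

  module _ (key : Fin n → ℕ) where

    towards-smaller : Fin n → Fin m → Bool
    towards-smaller v e = (src e =ᵥ v ∧ (key (tgt e) ℕ.<ᵇ key (src e))) ∨ (tgt e =ᵥ v ∧ (key (src e) ℕ.<ᵇ key (tgt e)))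

    towards-smaller-descends : ∀ v e → towards-smaller v e ≡ true →
                               (src e ≡ v × key (tgt e) < key v) ⊎ (tgt e ≡ v × key (src e) < key v)
    towards-smaller-descends v e out-v with ∨-true {src e =ᵥ v ∧ (key (tgt e) ℕ.<ᵇ key (src e))} out-v
    ... | inj₁ from-src with src=v , lt ← ∧-true {src e =ᵥ v} from-src with refl ← =ᵥ⇒≡ src=v = inj₁ (refl , <ᵇ⇒<′ lt)
    ... | inj₂ from-tgt with tgt=v , lt ← ∧-true {tgt e =ᵥ v} from-tgt with refl ← =ᵥ⇒≡ tgt=v = inj₂ (refl , <ᵇ⇒<′ lt)

    towards-smaller-joins : ∀ {e v w} → Joins src tgt e v w → key w < key v → towards-smaller v e ≡ true
    towards-smaller-joins {e} (inj₁ (refl , refl)) lt rewrite =ᵥ-refl (src e) | <⇒<ᵇ′ lt = refl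
    towards-smaller-joins {e} (inj₂ (refl , refl)) lt rewrite =ᵥ-≢ (noLoop e) | =ᵥ-refl (tgt e) | <⇒<ᵇ′ lt = refl

    towards-smaller-total : Injective _≡_ _≡_ key → ∀ e → Σ (Fin n) λ v → towards-smaller v e ≡ true
    towards-smaller-total key-injective e with <-cmp (key (src e)) (key (tgt e))
    ... | tri< lt _ _ = tgt e , towards-smaller-joins (inj₂ (refl , refl)) lt
    ... | tri≈ _ eq _ = ⊥-elim (noLoop e (key-injective eq))
    ... | tri> _ _ gt = src e , towards-smaller-joins (inj₁ (refl , refl)) gt

    orientByKey : ∀ q → (∀ w → key q ≤ key w) →
                  (∀ v → v ≢ q → Σ (Fin m) λ e → Σ (Fin n) λ w → Joins src tgt e v w × key w < key v) → RootedOrientation q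
    orientByKey q root-minimal descent = record
      { out          = towards-smaller
      ; key          = key
      ; out-descends = towards-smaller-descends
      ; root-minimal = root-minimal
      ; out-nonempty = λ v v≢q → let (e , w , j , w<v) = descent v v≢q in e , towards-smaller-joins j w<v
      }

-- An upper bound for the degree of a parking function

∣_+1∣ : ℤ → ℕ
∣ z +1∣ = ∣ z ℤ.+ ⁺ 1 ∣

≥-1⇒≡∣+1∣-1 : ∀ z → -[1+ 0 ] ℤ.≤ z → z ≡ ⁺ ∣ z +1∣ ℤ.- ⁺ 1
≥-1⇒≡∣+1∣-1 (⁺ k)        _        = cong (λ j → ⁺ j ℤ.- ⁺ 1) (+-comm 1 k)
≥-1⇒≡∣+1∣-1 -[1+ 0 ]     _        = refl
≥-1⇒≡∣+1∣-1 -[1+ suc k ] (-≤- ())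

∑-single : ∀ {n} (g : Fin n → ℕ) xs v → Unique xs → v ∈ xs → ∑ (λ w → ind (w =ᵥ v) * g w) xs ≡ g v
∑-single g (x ∷ xs) v u (here refl) rewrite =ᵥ-refl x =
  trans (cong₂ _+_ (*-identityˡ (g x)) (∑-zero _ xs others)) (+-identityʳ _)
  where
    others : ∀ w → w ∈ xs → ind (w =ᵥ x) * g w ≡ 0
    others w w∈ rewrite =ᵥ-≢ (λ w≡x → Unique[x∷xs]⇒x∉xs u (subst (_∈ xs) w≡x w∈)) = refl
∑-single g (x ∷ xs) v u (there v∈) rewrite =ᵥ-≢ (λ x≡v → Unique[x∷xs]⇒x∉xs u (subst (_∈ xs) (sym x≡v) v∈)) =
  ∑-single g xs v (tail u) v∈

_∖_ : ∀ {n} → Subset n → Fin n → Subset n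
A ∖ v = tabulate (λ w → lookup A w ∧ not (w =ᵥ v))

lookup-∖ : ∀ {n} (A : Subset n) v w → lookup (A ∖ v) w ≡ lookup A w ∧ not (w =ᵥ v)
lookup-∖ A v w = lookup∘tabulate (λ w → lookup A w ∧ not (w =ᵥ v)) w

∑ₛ : ∀ {n} → Subset n → (Fin n → ℕ) → ℕ
∑ₛ {n} A g = ∑ (λ w → ind (lookup A w) * g w) (allFin n)

∑ₛ-∖ : ∀ {n} g (A : Subset n) v → lookup A v ≡ true → ∑ₛ A g ≡ ∑ₛ (A ∖ v) g + g v
∑ₛ-∖ {n} g A v v∈A = begin
    ∑ₛ A g                                                               ≡⟨ ∑-cong (allFin n) split ⟩
    ∑ (λ w → ind (lookup (A ∖ v) w) * g w + ind (w =ᵥ v) * g w) (allFin n) ≡⟨ ∑-+ _ _ (allFin n) ⟩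
    ∑ₛ (A ∖ v) g + ∑ (λ w → ind (w =ᵥ v) * g w) (allFin n)                ≡⟨ cong (∑ₛ (A ∖ v) g +_) (∑-single g (allFin n) v (allFin⁺ n) (∈-allFin v)) ⟩
    ∑ₛ (A ∖ v) g + g v                                                   ∎
  where
    open ≡-Reasoning
    ind-split : ∀ a s x → (s ≡ true → a ≡ true) → ind a * x ≡ ind (a ∧ not s) * x + ind s * x
    ind-split true  true  x _   = refl
    ind-split true  false x _   = sym (+-identityʳ _)
    ind-split false true  x s⇒a with () ← s⇒a refl
    ind-split false false x _   = refl
    split : ∀ w → ind (lookup A w) * g w ≡ ind (lookup (A ∖ v) w) * g w + ind (w =ᵥ v) * g w
    split w rewrite lookup-∖ A v w = ind-split (lookup A w) (w =ᵥ v) (g w) (λ w=v → subst (λ u → lookup A u ≡ true) (sym (=ᵥ⇒≡ w=v)) v∈A)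

ind-touches-split : ∀ a b s t → (s ≡ true → a ≡ true) → (t ≡ true → b ≡ true) → (s ≡ true → t ≡ true → ⊥) →
                    ind (a ∨ b) ≡ ind ((a ∧ not s) ∨ (b ∧ not t)) + ind ((s ∧ not b) ∨ (t ∧ not a))
ind-touches-split _     _     true  true  _   _   s∧t = ⊥-elim (s∧t refl refl)
ind-touches-split false _     true  _     s⇒a _   _   with () ← s⇒a refl
ind-touches-split _     false _     true  _   t⇒b _   with () ← t⇒b refl
ind-touches-split true  true  true  false _   _   _   = refl
ind-touches-split true  false true  false _   _   _   = refl
ind-touches-split true  true  false true  _   _   _   = refl
ind-touches-split false true  false true  _   _   _   = refl
ind-touches-split true  true  false false _   _   _   = refl
ind-touches-split true  false false false _   _   _   = refl
ind-touches-split false true  false false _   _   _   = refl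
ind-touches-split false false false false _   _   _   = refl

module _ {n m : ℕ} (G : Graph n m) where
  open Graph G

  touches : Subset n → Fin m → Bool
  touches A e = lookup A (src e) ∨ lookup A (tgt e)

  count-touches-∖ : ∀ A v → lookup A v ≡ true → count (touches A) (allFin m) ≡ count (touches (A ∖ v)) (allFin m) + dOut G A v
  count-touches-∖ A v v∈A = begin
      count (touches A) (allFin m)                                                ≡⟨ count≡∑ind (touches A) (allFin m) ⟩
      ∑ (λ e → ind (touches A e)) (allFin m)                                      ≡⟨ ∑-cong (allFin m) split ⟩
      ∑ (λ e → ind (touches (A ∖ v) e) + ind (leaves G A v e)) (allFin m)         ≡⟨ ∑-+ _ _ (allFin m) ⟩
      ∑ (λ e → ind (touches (A ∖ v) e)) (allFin m) + ∑ (λ e → ind (leaves G A v e)) (allFin m)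
        ≡⟨ cong₂ _+_ (count≡∑ind (touches (A ∖ v)) (allFin m)) (count≡∑ind (leaves G A v) (allFin m)) ⟨
      count (touches (A ∖ v)) (allFin m) + dOut G A v                              ∎
    where
      open ≡-Reasoning
      ∈A : ∀ {x} → (x =ᵥ v) ≡ true → lookup A x ≡ true
      ∈A x=v = subst (λ u → lookup A u ≡ true) (sym (=ᵥ⇒≡ x=v)) v∈A
      split : ∀ e → ind (touches A e) ≡ ind (touches (A ∖ v) e) + ind (leaves G A v e)
      split e rewrite lookup-∖ A v (src e) | lookup-∖ A v (tgt e) =
        ind-touches-split (lookup A (src e)) (lookup A (tgt e)) (src e =ᵥ v) (tgt e =ᵥ v) ∈A ∈A
          (λ s=v t=v → noLoop e (trans (=ᵥ⇒≡ s=v) (sym (=ᵥ⇒≡ t=v))))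

  module _ (q : Fin n) (g : Fin n → ℤ) (g-parking : IsParking G q g) where
    private
      g≥-1 : ∀ v → -[1+ 0 ] ℤ.≤ g v
      g≥-1 = proj₁ (proj₂ g-parking)

    -- Removing the vertex v supplied by the parking condition loses ∣ g v +1∣ ≤ dOut A v touching edges.
    ∑ₛ∣g+1∣≤touches : ∀ k A → ∑ₛ A (λ _ → 1) ≤ k → lookup A q ≡ false → ∑ₛ A (λ w → ∣ g w +1∣) ≤ count (touches A) (allFin m)
    ∑ₛ∣g+1∣≤touches k A |A|≤k q∉A with nonempty? A
    ... | no A=∅ = subst (_≤ _) (sym (∑-zero _ (allFin n) λ w _ → cong (λ b → ind b * ∣ g w +1∣) (∉ₛ⇒lookup≡false A w (λ w∈A → A=∅ (w , w∈A))))) z≤n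
    ... | yes A≠∅ with v , v∈A , _ , gv<d ← proj₂ (proj₂ g-parking) A A≠∅ (lookup≡false⇒∉ₛ A q q∉A)
      = descend k |A|≤k
      where
        v∈A′ : lookup A v ≡ true
        v∈A′ = []=⇒lookup v∈A
        ∣gv+1∣≤d : ∣ g v +1∣ ≤ dOut G A v
        ∣gv+1∣≤d with ∣ g v +1∣ | subst (ℤ._< ⁺ dOut G A v) (≥-1⇒≡∣+1∣-1 (g v) (g≥-1 v)) gv<d
        ... | zero  | _   = z≤n
        ... | suc h | h<d = ℤP.drop‿+<+ h<d
        |A|≡ : ∑ₛ A (λ _ → 1) ≡ suc (∑ₛ (A ∖ v) (λ _ → 1))
        |A|≡ = trans (∑ₛ-∖ (λ _ → 1) A v v∈A′) (+-comm _ 1)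
        q∉A∖v : lookup (A ∖ v) q ≡ false
        q∉A∖v rewrite lookup-∖ A v q | q∉A = refl
        descend : ∀ k′ → ∑ₛ A (λ _ → 1) ≤ k′ → ∑ₛ A (λ w → ∣ g w +1∣) ≤ count (touches A) (allFin m)
        descend zero    |A|≤0 with () ← subst (_≤ 0) |A|≡ |A|≤0
        descend (suc k′) |A|≤1+k′ = begin
            ∑ₛ A (λ w → ∣ g w +1∣)                         ≡⟨ ∑ₛ-∖ (λ w → ∣ g w +1∣) A v v∈A′ ⟩
            ∑ₛ (A ∖ v) (λ w → ∣ g w +1∣) + ∣ g v +1∣
              ≤⟨ +-mono-≤ (∑ₛ∣g+1∣≤touches k′ (A ∖ v) (ℕ.s≤s⁻¹ (subst (_≤ suc k′) |A|≡ |A|≤1+k′)) q∉A∖v) ∣gv+1∣≤d ⟩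
            count (touches (A ∖ v)) (allFin m) + dOut G A v ≡⟨ count-touches-∖ A v v∈A′ ⟨
            count (touches A) (allFin m)                  ∎
          where open ≤-Reasoning

    sumℤ-parking≤m-n : sumℤ g ℤ.≤ ⁺ m ℤ.- ⁺ n
    sumℤ-parking≤m-n = subst (ℤ._≤ ⁺ m ℤ.- ⁺ n) (sym sumℤ≡) (ℤP.+-monoˡ-≤ (ℤ.- ⁺ n) (+≤+ ∑∣g+1∣≤m))
      where
        A₀ : Subset n
        A₀ = tabulate (λ w → not (w =ᵥ q))
        sumℤ≡ : sumℤ g ≡ ⁺ ∑ (λ w → ∣ g w +1∣) (allFin n) ℤ.- ⁺ n
        sumℤ≡ = trans (cong (foldr ℤ._+_ (⁺ 0)) (map-cong (λ v → ≥-1⇒≡∣+1∣-1 (g v) (g≥-1 v)) (allFin n)))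
                  (trans (∑ℤ-pred (λ w → ∣ g w +1∣) (allFin n)) (cong (λ k → ⁺ ∑ (λ w → ∣ g w +1∣) (allFin n) ℤ.- ⁺ k) (length-allFin n)))
        restrict : ∀ w → ∣ g w +1∣ ≡ ind (lookup A₀ w) * ∣ g w +1∣
        restrict w rewrite lookup∘tabulate (λ w → not (w =ᵥ q)) w with w ≟ q
        ... | yes refl rewrite proj₁ g-parking = refl
        ... | no _     = sym (+-identityʳ _)
        q∉A₀ : lookup A₀ q ≡ false
        q∉A₀ rewrite lookup∘tabulate (λ w → not (w =ᵥ q)) q | =ᵥ-refl q = refl
        ∑∣g+1∣≤m : ∑ (λ w → ∣ g w +1∣) (allFin n) ≤ m
        ∑∣g+1∣≤m = begin
          ∑ (λ w → ∣ g w +1∣) (allFin n) ≡⟨ ∑-cong (allFin n) restrict ⟩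
          ∑ₛ A₀ (λ w → ∣ g w +1∣)         ≤⟨ ∑ₛ∣g+1∣≤touches _ A₀ ≤-refl q∉A₀ ⟩
          count (touches A₀) (allFin m)   ≤⟨ count≤length (touches A₀) (allFin m) ⟩
          length (allFin m)               ≡⟨ length-allFin m ⟩
          m                               ∎
          where open ≤-Reasoning

-- The digraph D of the construction of μ(T)

module _ {n m : ℕ} (G : Graph n m) (q : Fin n) (σ : Fin m → ℕ) (T : Fin m → Bool) (t : SpanningTree G T) where
  open Graph G
  open SpanningTree t

  private
    Pₜ : (i : Fin n) → Walk G T i q
    Pₜ = P G q σ T t

    onPathₜ : ∀ {a b} → Walk G T a b → Fin n → Bool
    onPathₜ = onPath G q σ T t

    prefMaxₜ : ∀ {a b} → (Fin n → Bool) → Walk G T a b → ℕ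
    prefMaxₜ = prefMax G q σ T t

  P-unique : ∀ i → Unique (verts G (Pₜ i))
  P-unique i = proj₂ (connected i q)

  onPath⁺ : ∀ {a b} (p : Walk G T a b) {c} → c ∈ verts G p → onPathₜ p c ≡ true
  onPath⁺ p {c} c∈ with any? (c ≟_) (verts G p)
  ... | yes _  = refl
  ... | no c∉  = ⊥-elim (c∉ c∈)

  onPath⁻ : ∀ {a b} (p : Walk G T a b) {c} → onPathₜ p c ≡ true → c ∈ verts G p
  onPath⁻ p {c} on with any? (c ≟_) (verts G p)
  ... | yes c∈ = c∈

  maxσ : List (Fin m) → ℕ
  maxσ = foldr (λ e r → suc (σ e) ⊔ r) 0

  maxσ-attained : ∀ es → 0 < maxσ es → Σ (Fin m) λ f → f ∈ es × maxσ es ≡ suc (σ f)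
  maxσ-attained (e ∷ es) pos with ≤-total (maxσ es) (suc (σ e))
  ... | inj₁ es≤e = e , here refl , m≥n⇒m⊔n≡m es≤e
  ... | inj₂ e≤es with f , f∈ , max≡ ← maxσ-attained es (≤-trans (s≤s z≤n) e≤es) = f , there f∈ , trans (m≤n⇒m⊔n≡n e≤es) max≡

  maxσ-upper : ∀ {f} es → f ∈ es → suc (σ f) ≤ maxσ es
  maxσ-upper (e ∷ es) (here refl) = m≤m⊔n (suc (σ e)) (maxσ es)
  maxσ-upper (e ∷ es) (there f∈)  = ≤-trans (maxσ-upper es f∈) (m≤n⊔m (suc (σ e)) (maxσ es))

  maxσ≡0⇒[] : ∀ es → maxσ es ≡ 0 → es ≡ []
  maxσ≡0⇒[] []       _   = refl
  maxσ≡0⇒[] (e ∷ es) max≡0 with () ← subst (suc (σ e) ≤_) max≡0 (maxσ-upper (e ∷ es) (here refl))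

  prefMax-stop : ∀ {a w b} (stop : Fin n → Bool) e s (j : Joins src tgt e a w) (p : Walk G T w b) →
                 stop a ≡ true → prefMaxₜ stop (step e s j p) ≡ 0
  prefMax-stop stop e s j p a-stops rewrite a-stops = refl

  prefMax-pass : ∀ {a w b} (stop : Fin n → Bool) e s (j : Joins src tgt e a w) (p : Walk G T w b) →
                 stop a ≡ false → prefMaxₜ stop (step e s j p) ≡ suc (σ e) ⊔ prefMaxₜ stop p
  prefMax-pass stop e s j p a-passes rewrite a-passes = refl

  record FirstHit (stop : Fin n → Bool) {a b : Fin n} (p : Walk G T a b) : Set where
    field
      hit         : Fin n
      hit-stops   : stop hit ≡ true
      hit∈        : hit ∈ verts G p
      pre         : Walk G T a hit
      suf         : Walk G T hit b
      edges-split : edges G p ≡ edges G pre ++ edges G suf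
      prefMax≡    : prefMaxₜ stop p ≡ maxσ (edges G pre)
      pre-hit     : ∀ {c} → c ∈ verts G pre → stop c ≡ true → c ≡ hit
      stops∈suf   : ∀ {c} → c ∈ verts G p → stop c ≡ true → c ∈ verts G suf
      pre-unique  : Unique (verts G pre)
      suf-unique  : Unique (verts G suf)
      pre⊆        : verts G pre ⊆ verts G p

  firstHit : ∀ (stop : Fin n → Bool) {a b} (p : Walk G T a b) → stop b ≡ true → Unique (verts G p) → FirstHit stop p
  firstHit stop {a} [] b-stops u = record
    { hit = a ; hit-stops = b-stops ; hit∈ = here refl ; pre = [] ; suf = [] ; edges-split = refl ; prefMax≡ = refl
    ; pre-hit = λ { (here refl) _ → refl } ; stops∈suf = λ c∈ _ → c∈ ; pre-unique = u ; suf-unique = u ; pre⊆ = λ c∈ → c∈ }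
  firstHit stop {a} (step e s j p) b-stops u with stop a in stop-a
  ... | true = record
    { hit = a ; hit-stops = stop-a ; hit∈ = here refl ; pre = [] ; suf = step e s j p ; edges-split = refl ; prefMax≡ = prefMax-stop stop e s j p stop-a
    ; pre-hit = λ { (here refl) _ → refl } ; stops∈suf = λ c∈ _ → c∈ ; pre-unique = Unique-∷ (λ ()) []
    ; suf-unique = u ; pre⊆ = λ { (here refl) → here refl } }
  ... | false = record
    { hit = hit ; hit-stops = hit-stops ; hit∈ = there hit∈ ; pre = step e s j pre ; suf = suf
    ; edges-split = cong (e ∷_) edges-split ; prefMax≡ = trans (prefMax-pass stop e s j p stop-a) (cong (suc (σ e) ⊔_) prefMax≡)
    ; pre-hit = λ { (here refl) a-stop → a-doesn't-stop a-stop ; (there c∈) → pre-hit c∈ }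
    ; stops∈suf = λ { (here refl) a-stop → a-doesn't-stop a-stop ; (there c∈) → stops∈suf c∈ }
    ; pre-unique = Unique-∷ (λ a∈ → Unique[x∷xs]⇒x∉xs u (pre⊆ a∈)) pre-unique ; suf-unique = suf-unique
    ; pre⊆ = λ { (here refl) → here refl ; (there c∈) → there (pre⊆ c∈) } }
    where
      open FirstHit (firstHit stop p b-stops (tail u))
      a-doesn't-stop : ∀ {A : Set} → stop a ≡ true → A
      a-doesn't-stop a-stop with () ← trans (sym a-stop) stop-a

  -- Splits P_x at meet(x,y); its prefMax≡ turns e_{xy} into the largest edge of the prefix.
  meetSplit : ∀ x y → FirstHit (onPathₜ (Pₜ y)) (Pₜ x)
  meetSplit x y = firstHit _ (Pₜ x) (onPath⁺ (Pₜ y) (last∈verts G (Pₜ y))) (P-unique x)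

  meet-tails-agree : ∀ x y → edges G (FirstHit.suf (meetSplit x y)) ≡ edges G (FirstHit.suf (meetSplit y x))
                           × FirstHit.hit (meetSplit x y) ≡ FirstHit.hit (meetSplit y x)
  meet-tails-agree x y = tails≡ , edges≡[]⇒≡ G A.pre (++-conicalˡ (edges G A.pre) (edges G B.pre) detour≡[])
    where
      module X = FirstHit (meetSplit x y)
      module Y = FirstHit (meetSplit y x)
      module A = SplitAt (splitAt G X.suf X.suf-unique (X.stops∈suf (onPath⁻ (Pₜ x) Y.hit-stops) (onPath⁺ (Pₜ y) Y.hit∈)))
      module B = SplitAt (splitAt G Y.suf Y.suf-unique (Y.stops∈suf (onPath⁻ (Pₜ y) X.hit-stops) (onPath⁺ (Pₜ x) X.hit∈)))
      -- X.suf passes through Y.hit and Y.suf through X.hit, so by uniqueness of tree paths the detour A.pre ++ B.pre is empty.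
      cycle : edges G X.suf ≡ (edges G A.pre ++ edges G B.pre) ++ edges G X.suf
      cycle = begin
        edges G X.suf                                            ≡⟨ A.edges-split ⟩
        edges G A.pre ++ edges G A.suf                           ≡⟨ cong (edges G A.pre ++_) (tree-path-unique G t A.suf Y.suf A.suf-unique Y.suf-unique) ⟩
        edges G A.pre ++ edges G Y.suf                           ≡⟨ cong (edges G A.pre ++_) B.edges-split ⟩
        edges G A.pre ++ (edges G B.pre ++ edges G B.suf)        ≡⟨ cong (λ es → edges G A.pre ++ (edges G B.pre ++ es)) (tree-path-unique G t B.suf X.suf B.suf-unique X.suf-unique) ⟩
        edges G A.pre ++ (edges G B.pre ++ edges G X.suf)        ≡⟨ ++-assoc (edges G A.pre) _ _ ⟨
        (edges G A.pre ++ edges G B.pre) ++ edges G X.suf        ∎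
        where open ≡-Reasoning
      detour≡[] : edges G A.pre ++ edges G B.pre ≡ []
      detour≡[] = ++-identityˡ-unique _ cycle
      tails≡ : edges G X.suf ≡ edges G Y.suf
      tails≡ = begin
        edges G X.suf                    ≡⟨ tree-path-unique G t B.suf X.suf B.suf-unique X.suf-unique ⟨
        edges G B.suf                    ≡⟨ cong (_++ edges G B.suf) (++-conicalʳ (edges G A.pre) (edges G B.pre) detour≡[]) ⟨
        edges G B.pre ++ edges G B.suf   ≡⟨ B.edges-split ⟨
        edges G Y.suf                    ∎
        where open ≡-Reasoning

  -- π encodes the edge set of Pᵢ in binary with digit positions σ; comparing e_{ij} with e_{ji} then compares π.
  π : Fin n → ℕ
  π v = weight (map σ (edges G (Pₜ v)))

  weight-σ-++ : ∀ es fs → weight (map σ (es ++ fs)) ≡ weight (map σ es) + weight (map σ fs)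
  weight-σ-++ es fs = trans (cong weight (map-++ σ es fs)) (weight-++ (map σ es) (map σ fs))

  π-split : ∀ {stop x} (H : FirstHit stop (Pₜ x)) →
            π x ≡ weight (map σ (edges G (FirstHit.pre H))) + weight (map σ (edges G (FirstHit.suf H)))
  π-split H = trans (cong (λ es → weight (map σ es)) (FirstHit.edges-split H)) (weight-σ-++ (edges G (FirstHit.pre H)) _)

  private
    firstEdgeIsₜ : ∀ {u v} → Fin m → Walk G T u v → Bool
    firstEdgeIsₜ = firstEdgeIs G q σ T t

  firstEdgeIs-step : ∀ {a w b} e s (j : Joins src tgt e a w) (p : Walk G T w b) → firstEdgeIsₜ e (step e s j p) ≡ true
  firstEdgeIs-step e s j p with e ≟ e
  ... | yes _   = refl
  ... | no e≢e  = ⊥-elim (e≢e refl)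

  first-edge-descends : ∀ {v} (p : Walk G T v q) → Unique (verts G p) → ∀ e → firstEdgeIsₜ e p ≡ true →
                        Σ (Fin n) λ w → Joins src tgt e v w × π w < weight (map σ (edges G p))
  first-edge-descends (step {_} {w} e₁ s j p) u e first with e ≟ e₁
  ... | yes refl = w , j , subst (_< weight (map σ (edges G (step e₁ s j p))))
                                 (cong (λ es → weight (map σ es)) (tree-path-unique G t p (Pₜ w) (tail u) (P-unique w)))
                                 (m<n+m (weight (map σ (edges G p))) (m^n>0 2 (σ e₁)))

  π-root : π q ≡ 0
  π-root = cong (λ es → weight (map σ es)) (closed-path (Pₜ q) (P-unique q))
    where
      closed-path : (p : Walk G T q q) → Unique (verts G p) → edges G p ≡ []
      closed-path []             _ = refl
      closed-path (step e s j p) u = ⊥-elim (Unique[x∷xs]⇒x∉xs u (last∈verts G p))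

  π>0 : ∀ {v} → v ≢ q → 0 < π v
  π>0 {v} v≢q with Pₜ v
  ... | []           = ⊥-elim (v≢q refl)
  ... | step e _ _ p = ≤-trans (m^n>0 2 (σ e)) (m≤m+n _ _)

  first-edge-exists : ∀ {v} (p : Walk G T v q) → v ≢ q → Σ (Fin m) λ e → T e ≡ true × firstEdgeIsₜ e p ≡ true
  first-edge-exists []             v≢q = ⊥-elim (v≢q refl)
  first-edge-exists (step e s j p) _   = e , s , firstEdgeIs-step e s j p

  -- A tree edge ab not on Pₐ makes b ∉ Pₐ (else Pₐ would close a cycle with it), so P_b is ab followed by Pₐ.
  tree-edge-first : ∀ e → T e ≡ true → (firstEdgeIsₜ e (Pₜ (src e)) ≡ true) ⊎ (firstEdgeIsₜ e (Pₜ (tgt e)) ≡ true)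
  tree-edge-first e Te = go (Pₜ (src e)) (P-unique (src e))
    where
      j : Joins src tgt e (src e) (tgt e)
      j = inj₁ (refl , refl)
      via-e : (pa : Walk G T (src e) q) → Unique (verts G pa) → e ∉ edges G pa → firstEdgeIsₜ e (Pₜ (tgt e)) ≡ true
      via-e pa ua e∉pa with any? (tgt e ≟_) (verts G pa)
      ... | yes b∈ = ⊥-elim (no-cycle G t Te j S.pre (λ e∈pre → e∉pa (subst (e ∈_) (sym S.edges-split) (∈-++⁺ˡ e∈pre))))
        where module S = SplitAt (splitAt G pa ua b∈)
      ... | no b∉  = starts-with-e (Pₜ (tgt e)) (tree-path-unique G t (Pₜ (tgt e)) (step e Te (Joins-sym G j) pa) (P-unique _) (Unique-∷ b∉ ua))
        where
          starts-with-e : ∀ {b} (pb : Walk G T b q) {es} → edges G pb ≡ e ∷ es → firstEdgeIsₜ e pb ≡ true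
          starts-with-e (step e s j p) refl = firstEdgeIs-step e s j p
      go : (pa : Walk G T (src e) q) → Unique (verts G pa) → (firstEdgeIsₜ e pa ≡ true) ⊎ (firstEdgeIsₜ e (Pₜ (tgt e)) ≡ true)
      go [] ua = inj₂ (via-e [] ua (λ ()))
      go (step e₁ s₁ j₁ p) ua with e ≟ e₁
      ... | yes refl = inj₁ refl
      ... | no e≢e₁  = inj₂ (via-e (step e₁ s₁ j₁ p) ua λ { (here e≡e₁) → e≢e₁ e≡e₁ ; (there e∈p) → Unique[x∷xs]⇒x∉xs ua (joined∈verts G p e∈p j) })

  -- π with ties broken by the vertex index: an injective key that still decreases along the tree towards q.
  πₙ : Fin n → ℕ
  πₙ v = π v * n + toℕ v

  π<⇒πₙ< : ∀ x y → π x < π y → πₙ x < πₙ y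
  π<⇒πₙ< x y π<π = begin-strict
      π x * n + toℕ x  <⟨ +-monoʳ-< (π x * n) (toℕ<n x) ⟩
      π x * n + n      ≡⟨ +-comm (π x * n) n ⟩
      suc (π x) * n    ≤⟨ *-monoˡ-≤ n π<π ⟩
      π y * n          ≤⟨ m≤m+n (π y * n) (toℕ y) ⟩
      π y * n + toℕ y  ∎
    where open ≤-Reasoning

  πₙ-injective : Injective _≡_ _≡_ πₙ
  πₙ-injective {x} {y} eq with <-cmp (π x) (π y)
  ... | tri< lt _ _ = ⊥-elim (<⇒≢ (π<⇒πₙ< x y lt) eq)
  ... | tri> _ _ gt = ⊥-elim (<⇒≢ (π<⇒πₙ< y x gt) (sym eq))
  ... | tri≈ _ π≡ _ rewrite π≡ = toℕ-injective (+-cancelˡ-≡ (π y * n) _ _ eq)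

  πₙ-root-minimal : ∀ w → πₙ q ≤ πₙ w
  πₙ-root-minimal w with w ≟ q
  ... | yes refl = ≤-refl
  ... | no w≢q rewrite π-root = begin
      toℕ q    ≤⟨ <⇒≤ (toℕ<n q) ⟩
      n        ≡⟨ *-identityˡ n ⟨
      1 * n    ≤⟨ *-monoˡ-≤ n (π>0 w≢q) ⟩
      π w * n  ≤⟨ m≤m+n _ _ ⟩
      πₙ w     ∎
    where open ≤-Reasoning

  πₙ-descent : ∀ v → v ≢ q → Σ (Fin m) λ e → Σ (Fin n) λ w → Joins src tgt e v w × πₙ w < πₙ v
  πₙ-descent v v≢q with e , _ , first ← first-edge-exists (Pₜ v) v≢q
                   with w , j , π< ← first-edge-descends (Pₜ v) (P-unique v) e first = e , w , j , π<⇒πₙ< w v π<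

  parking-with-m-n≤sum : Σ (Fin n → ℤ) λ g → IsParking G q g × ⁺ m ℤ.- ⁺ n ℤ.≤ sumℤ g
  parking-with-m-n≤sum = parkingFn , isParking , all-oriented⇒m-n≤sum (towards-smaller-total G πₙ πₙ-injective)
    where open RootedOrientation (orientByKey G πₙ q πₙ-root-minimal πₙ-descent)

  module _ (σ-injective : Injective _≡_ _≡_ σ) where

    ≻⇒π> : ∀ x y → eVal G q σ T t y x < eVal G q σ T t x y → π y < π x
    ≻⇒π> x y e[yx]<e[xy] = begin-strict
        π y                            ≡⟨ π-split Y.meet ⟩
        weight (map σ (edges G Y.pre)) + weight (map σ (edges G Y.suf))
          ≡⟨ cong (λ es → weight (map σ (edges G Y.pre)) + weight (map σ es)) (proj₁ (meet-tails-agree x y)) ⟨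
        weight (map σ (edges G Y.pre)) + tail-weight
          <⟨ +-monoˡ-< tail-weight (weight-< (σ f) (map σ (edges G Y.pre)) Y-distinct Y-below-f) ⟩
        2 ^ σ f + tail-weight          ≤⟨ +-monoˡ-≤ tail-weight (weight-∈ (map σ (edges G X.pre)) (∈-map⁺ σ f∈X)) ⟩
        weight (map σ (edges G X.pre)) + tail-weight ≡⟨ π-split X.meet ⟨
        π x                            ∎
      where
        open ≤-Reasoning
        module X where
          meet = meetSplit x y
          open FirstHit meet public
        module Y where
          meet = meetSplit y x
          open FirstHit meet public
        tail-weight = weight (map σ (edges G X.suf))
        max<max : maxσ (edges G Y.pre) < maxσ (edges G X.pre)
        max<max = subst₂ _<_ Y.prefMax≡ X.prefMax≡ e[yx]<e[xy]
        f-attains = maxσ-attained (edges G X.pre) (≤-<-trans z≤n max<max)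
        f = proj₁ f-attains
        f∈X = proj₁ (proj₂ f-attains)
        Y-distinct : Unique (map σ (edges G Y.pre))
        Y-distinct = map⁺ σ-injective (path⇒Unique-edges G Y.pre Y.pre-unique)
        Y-below-f : ∀ {a} → a ∈ map σ (edges G Y.pre) → a < σ f
        Y-below-f a∈ with g , g∈ , refl ← ∈-map⁻ σ a∈ =
          ℕ.s≤s⁻¹ (subst (suc (σ g) <_) (proj₂ (proj₂ f-attains)) (≤-<-trans (maxσ-upper _ g∈) max<max))

    -- Distinct x, y have e_{xy} ≠ e_{yx}: both null would force x = meet = y, and a common largest edge would lie
    -- on both prefixes, so both its endpoints would be the meet.
    eVal-distinct : ∀ x y → x ≢ y → eVal G q σ T t x y ≢ eVal G q σ T t y x
    eVal-distinct x y x≢y e[xy]≡e[yx] with maxσ (edges G X.pre) ℕ.≟ 0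
      where module X = FirstHit (meetSplit x y)
    ... | yes max≡0 = x≢y (begin
        x      ≡⟨ edges≡[]⇒≡ G X.pre (maxσ≡0⇒[] _ max≡0) ⟩
        X.hit  ≡⟨ proj₂ (meet-tails-agree x y) ⟩
        Y.hit  ≡⟨ edges≡[]⇒≡ G Y.pre (maxσ≡0⇒[] _ (trans (sym X≡Y) max≡0)) ⟨
        y      ∎)
      where
        open ≡-Reasoning
        module X = FirstHit (meetSplit x y)
        module Y = FirstHit (meetSplit y x)
        X≡Y : maxσ (edges G X.pre) ≡ maxσ (edges G Y.pre)
        X≡Y = trans (sym X.prefMax≡) (trans e[xy]≡e[yx] Y.prefMax≡)
    ... | no max≢0 = noLoop f (trans src≡hit (sym tgt≡hit))
      where
        module X = FirstHit (meetSplit x y)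
        module Y = FirstHit (meetSplit y x)
        X≡Y : maxσ (edges G X.pre) ≡ maxσ (edges G Y.pre)
        X≡Y = trans (sym X.prefMax≡) (trans e[xy]≡e[yx] Y.prefMax≡)
        f-attains = maxσ-attained (edges G X.pre) (n≢0⇒n>0 max≢0)
        g-attains = maxσ-attained (edges G Y.pre) (subst (0 <_) X≡Y (n≢0⇒n>0 max≢0))
        f = proj₁ f-attains
        f∈Y : f ∈ edges G Y.pre
        f∈Y = subst (_∈ edges G Y.pre) (sym (σ-injective (suc-injective
                (trans (sym (proj₂ (proj₂ f-attains))) (trans X≡Y (proj₂ (proj₂ g-attains)))))))
                (proj₁ (proj₂ g-attains))
        X-ends = endpoints∈verts G X.pre (proj₁ (proj₂ f-attains))
        Y-ends = endpoints∈verts G Y.pre f∈Y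
        src≡hit : src f ≡ X.hit
        src≡hit = X.pre-hit (proj₁ X-ends) (onPath⁺ (Pₜ y) (Y.pre⊆ (proj₁ Y-ends)))
        tgt≡hit : tgt f ≡ X.hit
        tgt≡hit = X.pre-hit (proj₂ X-ends) (onPath⁺ (Pₜ y) (Y.pre⊆ (proj₂ Y-ends)))

    private
      outFromₜ : Fin n → Fin m → Bool
      outFromₜ = outFrom G q σ T t

      brokenₜ : Fin m → Bool
      brokenₜ = brokenᵇ G q σ T t

      _≻ₜ_ : Fin n → Fin n → Bool
      _≻ₜ_ = _≻ᵇ_ G q σ T t

    outFrom-tree : ∀ {v e} → T e ≡ true → outFromₜ v e ≡ firstEdgeIsₜ e (Pₜ v)
    outFrom-tree Te rewrite Te = refl

    outFrom-nontree : ∀ {v e} → T e ≡ false →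
                      outFromₜ v e ≡ (not (brokenₜ e) ∧ ((src e =ᵥ v ∧ (src e ≻ₜ tgt e)) ∨ (tgt e =ᵥ v ∧ (tgt e ≻ₜ src e))))
    outFrom-nontree Te rewrite Te = refl

    outFrom-descends : ∀ v e → outFromₜ v e ≡ true → (src e ≡ v × π (tgt e) < π v) ⊎ (tgt e ≡ v × π (src e) < π v)
    outFrom-descends v e out-v with bool-cases (T e)
    ... | inj₁ Te with first-edge-descends (Pₜ v) (P-unique v) e (trans (sym (outFrom-tree Te)) out-v)
    ...   | w , inj₁ (src≡v , refl) , π< = inj₁ (src≡v , π<)
    ...   | w , inj₂ (refl , tgt≡v) , π< = inj₂ (tgt≡v , π<)
    outFrom-descends v e out-v | inj₂ Te with ∨-true (proj₂ (∧-true (trans (sym (outFrom-nontree Te)) out-v)))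
    ... | inj₁ src-out with ∧-true {src e =ᵥ v} src-out
    ...   | src=v , src≻tgt with refl ← =ᵥ⇒≡ src=v = inj₁ (refl , ≻⇒π> (src e) (tgt e) (<ᵇ⇒<′ src≻tgt))
    outFrom-descends v e out-v | inj₂ Te | inj₂ tgt-out with ∧-true {tgt e =ᵥ v} tgt-out
    ...   | tgt=v , tgt≻src with refl ← =ᵥ⇒≡ tgt=v = inj₂ (refl , ≻⇒π> (tgt e) (src e) (<ᵇ⇒<′ tgt≻src))

    -- Its parkingFn is μ(T) by definition.
    D : RootedOrientation G q
    D = record
      { out          = outFromₜ
      ; key          = π
      ; out-descends = outFrom-descends
      ; root-minimal = λ w → subst (_≤ π w) (sym π-root) z≤n
      ; out-nonempty = λ v v≢q → let (e , Te , first) = first-edge-exists (Pₜ v) v≢q in e , trans (outFrom-tree Te) first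
      }

    BrokenCircuit⇒brokenᵇ : ∀ e → BrokenCircuit G q σ T t e → brokenₜ e ≡ true
    BrokenCircuit⇒brokenᵇ e (Te , larger) rewrite Te
      with all? (λ f → σ f ℕ.<? σ e) (edges G (treePath G q σ T t (src e) (tgt e)))
    ... | yes _          = refl
    ... | no ¬larger     = ⊥-elim (¬larger larger)

    brokenᵇ⇒BrokenCircuit : ∀ e → brokenₜ e ≡ true → BrokenCircuit G q σ T t e
    brokenᵇ⇒BrokenCircuit e broken with T e
    ... | false with all? (λ f → σ f ℕ.<? σ e) (edges G (treePath G q σ T t (src e) (tgt e)))
    ...   | yes larger = refl , larger

    safe⇒all-oriented : Safe G q σ T t → ∀ e → Σ (Fin n) λ v → outFromₜ v e ≡ true
    safe⇒all-oriented safe e with bool-cases (T e)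
    ... | inj₁ Te with tree-edge-first e Te
    ...   | inj₁ first = src e , trans (outFrom-tree Te) first
    ...   | inj₂ first = tgt e , trans (outFrom-tree Te) first
    safe⇒all-oriented safe e | inj₂ Te with bool-cases (brokenₜ e)
    ... | inj₁ broken = ⊥-elim (safe e (brokenᵇ⇒BrokenCircuit e broken))
    ... | inj₂ unbroken with <-cmp (eVal G q σ T t (tgt e) (src e)) (eVal G q σ T t (src e) (tgt e))
    ...   | tri< src≻tgt _ _ = src e , from-src
      where
        from-src : outFromₜ (src e) e ≡ true
        from-src rewrite outFrom-nontree {src e} Te | unbroken | =ᵥ-refl (src e) | <⇒<ᵇ′ src≻tgt = refl
    ...   | tri≈ _ e≡ _      = ⊥-elim (eVal-distinct (src e) (tgt e) (noLoop e) (sym e≡))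
    ...   | tri> _ _ tgt≻src = tgt e , from-tgt
      where
        from-tgt : outFromₜ (tgt e) e ≡ true
        from-tgt rewrite outFrom-nontree {tgt e} Te | unbroken | =ᵥ-≢ (noLoop e) | =ᵥ-refl (tgt e) | <⇒<ᵇ′ tgt≻src = refl

    broken⇒unoriented : ∀ e → BrokenCircuit G q σ T t e → ∀ v → outFromₜ v e ≡ false
    broken⇒unoriented e bc v rewrite outFrom-nontree {v} (proj₁ bc) | BrokenCircuit⇒brokenᵇ e bc = refl

mainTheorem8 : ∀ {n m : ℕ} (G : Graph n m) → Connected G →
    (q : Fin n) (σ : Fin m → ℕ) → Injective _≡_ _≡_ σ →
    (T : Fin m → Bool) (t : SpanningTree G T) →
    IsMaxParking G q (μ G q σ T t) ⇔ Safe G q σ T t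
mainTheorem8 G _ q σ σ-injective T t = mk⇔ maximal⇒safe safe⇒maximal
  where
    open RootedOrientation (D G q σ T t σ-injective)
    safe⇒maximal : Safe G q σ T t → IsMaxParking G q (μ G q σ T t)
    safe⇒maximal safe = isParking , λ g g-parking →
      ℤP.≤-trans (sumℤ-parking≤m-n G q g g-parking) (all-oriented⇒m-n≤sum (safe⇒all-oriented G q σ T t σ-injective safe))
    maximal⇒safe : IsMaxParking G q (μ G q σ T t) → Safe G q σ T t
    maximal⇒safe (_ , maximal) e broken =
      let (g , g-parking , m-n≤g) = parking-with-m-n≤sum G q σ T t in
      ℤP.<⇒≱ (unoriented⇒sum<m-n e (broken⇒unoriented G q σ T t σ-injective e broken)) (ℤP.≤-trans m-n≤g (maximal g g-parking))
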